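{- A set of gcd conditions $(\mathcal{Q},f)$ is admissible if and only if for every prime $p$ and every element $T \in \mathcal{Q}$, $g_p(T) = \min \{ v_i^{(p)} \mid i \in T \}$.
   Context: Let $k \geq 2$ be an integer and $S = \{1,2,\dots,k\}$. Let $\mathcal{Q}$ be a collection of subsets of $S$, each having at least $2$ elements, and let $f: \mathcal{Q} \to \mathbb{N}$ (here $\mathbb{N}$ denotes the positive integers). The pair $(\mathcal{Q},f)$ is called a set of gcd conditions: a tuple $(n_1,\dots,n_k) \in \mathbb{N}^k$ satisfies it if $f(T) = \gcd\{ n_i \mid i \in T \}$ for every $T \in \mathcal{Q}$. The set of gcd conditions $(\mathcal{Q},f)$ is admissible if there exists at least one tuple in $\mathbb{N}^k$ satisfying all these conditions. For a prime $p$ and $T \in \mathcal{Q}$, let $g_p(T) := \operatorname{ord}_p(f(T))$ be the exponent of $p$ in $f(T)$. For each $i \in S$ and prime $p$, define $v_i^{(p)} := \max\left( \{0\} \cup \{ g_p(T) \mid T \in \mathcal{Q},\ i \in T \} \right)$. -}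

module Defs where

open import Data.Nat using (ℕ; zero; suc; _⊔_; _⊓_; _≤_)
open import Data.Nat.GCD using (gcd)
open import Data.Nat.DivMod using (_/_)
open import Data.Nat.Divisibility using (_∣?_)
open import Data.Bool using (Bool; true; false; if_then_else_)
open import Data.Fin using (Fin)
open import Data.Fin.Subset using (Subset; ∣_∣)
open import Data.Fin.Subset.Properties using (_∈?_)
open import Data.List using (List; []; _∷_; foldr; filter; allFin)
open import Data.List.Relation.Unary.All using (All)
open import Data.Product using (Σ; _×_)
open import Data.Vec using (lookup)
open import Data.Vec.Functional using (Vector)
open import Relation.Binary.PropositionalEquality using (_≡_)
open import Relation.Nullary using (yes; no)

-- S = {1,…,k} is modelled as Fin k; subsets of S as  Subset k  (Vec Bool k, true = member).

elems : ∀ {k} → Subset k → List (Fin k)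
elems {k} T = filter (_∈? T) (allFin k)

gcdOn : ∀ {k} → Vector ℕ k → Subset k → ℕ
gcdOn n T = foldr (λ i acc → gcd (n i) acc) 0 (elems T)

-- p-adic valuation ord_p m (meaningful for m ≥ 1, p ≥ 2); recursion fuel m suffices.
ordAux : ℕ → ℕ → ℕ → ℕ
ordAux zero p m = 0
ordAux (suc fuel) zero m = 0
ordAux (suc fuel) (suc zero) m = 0
ordAux (suc fuel) p@(suc (suc q)) zero = 0
ordAux (suc fuel) p@(suc (suc q)) m@(suc _) with p ∣? m
... | yes _ = suc (ordAux fuel p (m / p))
... | no _ = 0

ord : ℕ → ℕ → ℕ
ord p m = ordAux m p m

-- A set of gcd conditions on k-tuples: 𝒬 is a duplicate-free list of subsets of S,
-- f assigns a value to subsets (only its values on members of 𝒬 matter).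
record GcdConditions (k : ℕ) : Set where
  field
    Q : List (Subset k)
    f : Subset k → ℕ

-- Side conditions: every T ∈ 𝒬 has ≥ 2 elements and f(T) ∈ ℕ = positive integers
WellFormed : ∀ {k} → GcdConditions k → Set
WellFormed C = All (λ T → (2 ≤ ∣ T ∣) × (1 ≤ f T)) Q
  where open GcdConditions C

Satisfies : ∀ {k} → GcdConditions k → Vector ℕ k → Set
Satisfies C n = All (λ T → f T ≡ gcdOn n T) Q
  where open GcdConditions C

Admissible : ∀ {k} → GcdConditions k → Set
Admissible {k} C = Σ (Vector ℕ k) (λ n → ((i : Fin k) → 1 ≤ n i) × Satisfies C n)

g : ∀ {k} → GcdConditions k → ℕ → Subset k → ℕ
g C p T = ord p (GcdConditions.f C T)

v : ∀ {k} → GcdConditions k → ℕ → Fin k → ℕ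
v C p i = foldr (λ T acc → (if lookup T i then g C p T else 0) ⊔ acc) 0 (GcdConditions.Q C)

-- min { h i | i ∈ T }  (T nonempty; the empty-list default is irrelevant)
minOn : ∀ {k} → (Fin k → ℕ) → Subset k → ℕ
minOn h T with elems T
... | [] = 0
... | i ∷ is = foldr (λ j acc → h j ⊓ acc) (h i) is

{-# OPTIONS --safe #-}
module Submission where

-- Everything happens one prime at a time, because ord_p of gcd_{i ∈ T} n_i is the minimum of the
-- ord_p n_i over i ∈ T. If n satisfies the conditions, then f(T) ∣ n_i for i ∈ T gives
-- v_i ≤ ord_p n_i, so  min_T v ≤ min_T ord_p n = ord_p f(T) = g_p(T) ≤ min_T v.
-- Conversely, let n_i = lcm { f(T) | T ∈ 𝒬, i ∈ T }. Then f(T) divides gcd_T n. Also ord_p of an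
-- lcm is at most the maximum of the ord_p values, so ord_p n_i ≤ v_i. Hence at every prime
-- ord_p (gcd_T n) = min_T ord_p n ≤ min_T v = g_p(T) = ord_p f(T), which forces f(T) = gcd_T n.

open import Defs
open import Data.Bool using (true; false; if_then_else_)
open import Data.Fin using (Fin)
open import Data.Fin.Subset using (Subset; ∣_∣; Nonempty)
open import Data.Fin.Subset.Properties using (_∈?_; nonempty?; Empty-unique; ∣⊥∣≡0)
open import Data.List using (List; []; _∷_; foldr; allFin)
open import Data.List.Membership.Propositional using (_∈_)
open import Data.List.Membership.Propositional.Properties using (∈-filter⁺; ∈-filter⁻; ∈-allFin)
open import Data.List.Relation.Unary.All using (All; []; _∷_)
import Data.List.Relation.Unary.All as All
open import Data.List.Relation.Unary.Any using (here; there)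
open import Data.List.Relation.Unary.Unique.Propositional using (Unique)
open import Data.Nat
  using (ℕ; zero; suc; _*_; _^_; _≤_; _<_; _≥_; _⊔_; _⊓_; z≤n; s≤s; s≤s⁻¹; z<s; NonZero; nonTrivial⇒n>1)
open import Data.Nat.Properties
open import Data.Nat.Divisibility
open import Data.Nat.DivMod using (_/_; m/n<m; m*[n/m]≡n; m≥n⇒m/n>0)
open import Data.Nat.GCD using (gcd; gcd[m,n]∣m; gcd[m,n]∣n; gcd-greatest)
open import Data.Nat.LCM using (lcm; m∣lcm[m,n]; n∣lcm[m,n]; lcm-least)
open import Data.Nat.ListAction using (product)
open import Data.Nat.Primality using (Prime; euclidsLemma; prime⇒nonTrivial; prime⇒nonZero)
open import Data.Nat.Primality.Factorisation using (factorise)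
open import Data.Product using (∃-syntax; _×_; _,_; proj₁; proj₂)
open import Data.Sum using ([_,_]′)
open import Data.Vec using (lookup)
open import Data.Vec.Functional using (Vector)
open import Data.Vec.Properties using ([]=⇒lookup; lookup⇒[]=)
open import Function using (id; flip; _∘_)
open import Function.Bundles using (_⇔_; mk⇔)
open import Level using (Level)
open import Relation.Binary.Core using (Rel)
open import Relation.Binary.Definitions using (Reflexive; Transitive)
open import Relation.Binary.Lattice.Definitions using (Supremum; Infimum)
open import Relation.Binary.PropositionalEquality using (_≡_; refl; sym; trans; cong; subst)
open import Relation.Nullary using (yes; no; ¬_; contradiction)

module JoinFold {a ℓ : Level} {A : Set a} (_≼_ : Rel A ℓ) (_∨_ : A → A → A)
  (≼-refl : Reflexive _≼_) (≼-trans : Transitive _≼_) (sup : Supremum _≼_ _∨_) where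

  private
    x≼x∨y : ∀ x y → x ≼ (x ∨ y)
    x≼x∨y x y = proj₁ (sup x y)

    y≼x∨y : ∀ x y → y ≼ (x ∨ y)
    y≼x∨y x y = proj₁ (proj₂ (sup x y))

    ∨-least : ∀ {x y z} → x ≼ z → y ≼ z → (x ∨ y) ≼ z
    ∨-least = proj₂ (proj₂ (sup _ _)) _

  ⋁ : ∀ {I : Set} → (I → A) → A → List I → A
  ⋁ h b = foldr (λ i acc → h i ∨ acc) b

  module _ {I : Set} (h : I → A) where

    init≼⋁ : ∀ b xs → b ≼ ⋁ h b xs
    init≼⋁ b []       = ≼-refl
    init≼⋁ b (x ∷ xs) = ≼-trans (init≼⋁ b xs) (y≼x∨y (h x) _)

    ∈⇒≼⋁ : ∀ b {i xs} → i ∈ xs → h i ≼ ⋁ h b xs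
    ∈⇒≼⋁ b {xs = x ∷ xs} (here refl) = x≼x∨y (h x) _
    ∈⇒≼⋁ b {xs = x ∷ xs} (there i∈) = ≼-trans (∈⇒≼⋁ b i∈) (y≼x∨y (h x) _)

    ⋁-least : ∀ {b z xs} → b ≼ z → All (λ i → h i ≼ z) xs → ⋁ h b xs ≼ z
    ⋁-least b≼z []            = b≼z
    ⋁-least b≼z (hx≼z ∷ h≼z) = ∨-least hx≼z (⋁-least b≼z h≼z)

⊔-supremum : Supremum _≤_ _⊔_
⊔-supremum m n = m≤m⊔n m n , m≤n⊔m m n , λ _ → ⊔-lub

⊓-infimum : Infimum _≤_ _⊓_
⊓-infimum m n = m⊓n≤m m n , m⊓n≤n m n , λ _ → ⊓-glb

lcm-supremum : Supremum _∣_ lcm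
lcm-supremum m n = m∣lcm[m,n] m n , n∣lcm[m,n] m n , λ _ → lcm-least

gcd-infimum : Infimum _∣_ gcd
gcd-infimum m n = gcd[m,n]∣m m n , gcd[m,n]∣n m n , λ _ → gcd-greatest

module Max = JoinFold _≤_ _⊔_ ≤-refl ≤-trans ⊔-supremum
module Min = JoinFold _≥_ _⊓_ ≤-refl (flip ≤-trans) ⊓-infimum
module Lcm = JoinFold _∣_ lcm ∣-refl ∣-trans lcm-supremum
module Gcd = JoinFold (flip _∣_) gcd ∣-refl (flip ∣-trans) gcd-infimum

divisor>0 : ∀ {m n} → m ∣ n → 0 < n → 0 < m
divisor>0 {zero}  m∣n n>0 = contradiction (0∣⇒≡0 m∣n) (>⇒≢ n>0)
divisor>0 {suc _} _   _   = z<s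

lcm>0 : ∀ {m n} → 0 < m → 0 < n → 0 < lcm m n
lcm>0 {m} {n} m>0 n>0 = divisor>0 {lcm m n} (lcm-least (m∣m*n {m} n) (n∣m*n m {n})) (*-mono-≤ m>0 n>0)

^-monoʳ-∣ : ∀ p {m n} → m ≤ n → p ^ m ∣ p ^ n
^-monoʳ-∣ p {n = n} z≤n       = 1∣ (p ^ n)
^-monoʳ-∣ p         (s≤s m≤n) = *-monoʳ-∣ p (^-monoʳ-∣ p m≤n)

prime⇒1< : ∀ {p} → Prime p → 1 < p
prime⇒1< {p} pr = nonTrivial⇒n>1 p {{prime⇒nonTrivial pr}}

∃-prime-divisor : ∀ {n} → 1 < n → ∃[ p ] Prime p × p ∣ n
∃-prime-divisor {n@(suc _)} 1<n with factorise n
... | record { factors = [] ; isFactorisation = n≡1 } = contradiction n≡1 (>⇒≢ 1<n)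
... | record { factors = p ∷ ps ; isFactorisation = n≡p*Πps ; factorsPrime = pr ∷ _ } =
  p , pr , subst (p ∣_) (sym n≡p*Πps) (m∣m*n (product ps))

private
  quotient≤fuel : ∀ {p m fuel} .{{_ : NonZero p}} → 1 < p → suc m ≤ suc fuel → suc m / p ≤ fuel
  quotient≤fuel {p} {m} 1<p m≤fuel = s≤s⁻¹ (<-≤-trans (m/n<m (suc m) p 1<p) m≤fuel)

  ^ordAux∣ : ∀ {p} → 1 < p → ∀ fuel m → m ≤ fuel → p ^ ordAux fuel p m ∣ m
  ^ordAux∣ _ zero m _ = 1∣ m
  ^ordAux∣ (s≤s (s≤s z≤n)) (suc fuel) zero _ = 1∣ 0
  ^ordAux∣ {p} 1<p@(s≤s (s≤s z≤n)) (suc fuel) (suc m) m≤fuel with p ∣? suc m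
  ... | no  _   = 1∣ suc m
  ... | yes p∣m = subst (p * p ^ ordAux fuel p (suc m / p) ∣_) (m*[n/m]≡n p∣m)
    (*-monoʳ-∣ p (^ordAux∣ 1<p fuel (suc m / p) (quotient≤fuel 1<p m≤fuel)))

  ≤ordAux : ∀ {p} → 1 < p → ∀ fuel m {e} → 0 < m → m ≤ fuel → p ^ e ∣ m → e ≤ ordAux fuel p m
  ≤ordAux _ _ _ {zero} _ _ _ = z≤n
  ≤ordAux _ zero (suc m) {suc e} _ () _
  ≤ordAux {p} 1<p@(s≤s (s≤s z≤n)) (suc fuel) (suc m) {suc e} _ m≤fuel pᵉ⁺¹∣m with p ∣? suc m
  ... | no  p∤m = contradiction (m*n∣⇒m∣ p (p ^ e) pᵉ⁺¹∣m) p∤m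
  ... | yes p∣m = s≤s (≤ordAux 1<p fuel (suc m / p) (m≥n⇒m/n>0 (∣⇒≤ p∣m))
    (quotient≤fuel 1<p m≤fuel)
    (*-cancelˡ-∣ p (subst (p * p ^ e ∣_) (sym (m*[n/m]≡n p∣m)) pᵉ⁺¹∣m)))

module _ {p : ℕ} (1<p : 1 < p) where

  ^ord∣ : ∀ m → p ^ ord p m ∣ m
  ^ord∣ m = ^ordAux∣ 1<p m m ≤-refl

  ^∣⇒≤ord : ∀ {m e} → 0 < m → p ^ e ∣ m → e ≤ ord p m
  ^∣⇒≤ord {m} m>0 = ≤ordAux 1<p m m m>0 ≤-refl

  ≤ord⇒^∣ : ∀ {m e} → e ≤ ord p m → p ^ e ∣ m
  ≤ord⇒^∣ {m} e≤ord = ∣-trans (^-monoʳ-∣ p e≤ord) (^ord∣ m)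

  ord-mono-∣ : ∀ {m n} → 0 < n → m ∣ n → ord p m ≤ ord p n
  ord-mono-∣ {m} n>0 m∣n = ^∣⇒≤ord n>0 (∣-trans (^ord∣ m) m∣n)

  ord[1]≡0 : ord p 1 ≡ 0
  ord[1]≡0 = [ id , (λ p≡1 → contradiction p≡1 (>⇒≢ 1<p)) ]′
    (m^n≡1⇒n≡0∨m≡1 p (ord p 1) (∣1⇒≡1 (^ord∣ 1)))

  ord-cofactor : ∀ {m} → 0 < m → ∃[ u ] m ≡ u * p ^ ord p m × ¬ p ∣ u
  ord-cofactor {m} m>0 with ^ord∣ m
  ... | divides u m≡u*pᵉ = u , m≡u*pᵉ , λ p∣u →
    n≮n (ord p m) (^∣⇒≤ord m>0 (subst (p * p ^ ord p m ∣_) (sym m≡u*pᵉ) (*-monoˡ-∣ (p ^ ord p m) p∣u)))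

module _ {p : ℕ} (pr : Prime p) where
  private
    1<p = prime⇒1< pr
    instance _ = prime⇒nonZero pr

  ord-lcm≤ : ∀ {m n} → 0 < m → 0 < n → ord p (lcm m n) ≤ ord p m ⊔ ord p n
  ord-lcm≤ {m} {n} m>0 n>0 with ord-cofactor 1<p m>0 | ord-cofactor 1<p n>0
  ... | m′ , m≡ , p∤m′ | n′ , n≡ , p∤n′ = ≮⇒≥ λ e<ord → p∤m′n′
    (*-cancelʳ-∣ (p ^ e) {{m^n≢0 p e}} (∣-trans (≤ord⇒^∣ 1<p e<ord) (lcm-least m∣X n∣X)))
    where
    e = ord p m ⊔ ord p n
    X = (m′ * n′) * p ^ e
    m∣X : m ∣ X
    m∣X = subst (_∣ X) (sym m≡) (*-pres-∣ (m∣m*n {m′} n′) (^-monoʳ-∣ p (m≤m⊔n (ord p m) (ord p n))))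
    n∣X : n ∣ X
    n∣X = subst (_∣ X) (sym n≡) (*-pres-∣ (n∣m*n m′ {n′}) (^-monoʳ-∣ p (m≤n⊔m (ord p m) (ord p n))))
    p∤m′n′ : ¬ p ∣ m′ * n′
    p∤m′n′ = [ p∤m′ , p∤n′ ]′ ∘ euclidsLemma m′ n′ pr

∣⇒ord≤⇒≡ : ∀ {d m} → d ∣ m → 0 < m → (∀ p → Prime p → ord p m ≤ ord p d) → d ≡ m
∣⇒ord≤⇒≡ (divides zero m≡0) m>0 _ = contradiction m≡0 (>⇒≢ m>0)
∣⇒ord≤⇒≡ {d} (divides 1 m≡1*d) _ _ = sym (trans m≡1*d (*-identityˡ d))
∣⇒ord≤⇒≡ {d} {m} (divides q@(suc (suc _)) m≡q*d) m>0 ord≤ with ∃-prime-divisor {q} (s≤s (s≤s z≤n))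
... | p , pr , p∣q = contradiction (ord≤ p pr) (<⇒≱ (^∣⇒≤ord 1<p m>0 pᵒʳᵈ⁺¹∣m))
  where
  1<p = prime⇒1< pr
  pᵒʳᵈ⁺¹∣m : p ^ suc (ord p d) ∣ m
  pᵒʳᵈ⁺¹∣m = subst (p * p ^ ord p d ∣_) (sym m≡q*d) (*-pres-∣ p∣q (^ord∣ 1<p d))

∈-elems⁻ : ∀ {k} {T : Subset k} {i} → i ∈ elems T → lookup T i ≡ true
∈-elems⁻ {k} {T} i∈ = []=⇒lookup (proj₂ (∈-filter⁻ (_∈? T) {xs = allFin k} i∈))

∈-elems⁺ : ∀ {k} {T : Subset k} {i} → lookup T i ≡ true → i ∈ elems T
∈-elems⁺ {T = T} {i} T∋i = ∈-filter⁺ (_∈? T) (∈-allFin i) (lookup⇒[]= i T T∋i)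

∣T∣>0⇒Nonempty : ∀ {k} {T : Subset k} → 0 < ∣ T ∣ → Nonempty T
∣T∣>0⇒Nonempty {k} {T} ∣T∣>0 with nonempty? T
... | yes T≠∅ = T≠∅
... | no  T=∅ = contradiction (trans (cong ∣_∣ (Empty-unique T=∅)) (∣⊥∣≡0 k)) (>⇒≢ ∣T∣>0)

elems-nonempty : ∀ {k} {T : Subset k} → 0 < ∣ T ∣ → ∃[ i ] i ∈ elems T
elems-nonempty {k} {T} ∣T∣>0 with ∣T∣>0⇒Nonempty ∣T∣>0
... | i , i∈T = i , ∈-filter⁺ (_∈? T) (∈-allFin i) i∈T

module _ {k : ℕ} (h : Fin k → ℕ) where

  minOn≤ : ∀ T {i} → i ∈ elems T → minOn h T ≤ h i
  minOn≤ T i∈ with elems T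
  minOn≤ T (here refl) | j ∷ js = Min.init≼⋁ h (h j) js
  minOn≤ T (there i∈)  | j ∷ js = Min.∈⇒≼⋁ h (h j) i∈

  ≤minOn : ∀ T {e i} → i ∈ elems T → All (λ j → e ≤ h j) (elems T) → e ≤ minOn h T
  ≤minOn T i∈ e≤h with elems T
  ≤minOn T () e≤h | []
  ≤minOn T i∈ (e≤hj ∷ e≤h) | j ∷ js = Min.⋁-least h e≤hj e≤h

minOn-mono : ∀ {k} {h h′ : Fin k → ℕ} T {i} → i ∈ elems T → (∀ j → h j ≤ h′ j) → minOn h T ≤ minOn h′ T
minOn-mono {h = h} {h′} T i∈ h≤h′ =
  ≤minOn h′ T i∈ (All.tabulate λ {j} j∈ → ≤-trans (minOn≤ h T j∈) (h≤h′ j))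

module _ {k : ℕ} {n : Vector ℕ k} (n>0 : ∀ i → 0 < n i) where

  gcdOn>0 : ∀ {T i} → i ∈ elems T → 0 < gcdOn n T
  gcdOn>0 {i = i} i∈ = divisor>0 (Gcd.∈⇒≼⋁ n 0 i∈) (n>0 i)

  ord-gcdOn≤ : ∀ {p} → 1 < p → ∀ {T i} → i ∈ elems T → ord p (gcdOn n T) ≤ ord p (n i)
  ord-gcdOn≤ 1<p {i = i} i∈ = ord-mono-∣ 1<p (n>0 i) (Gcd.∈⇒≼⋁ n 0 i∈)

  ord-gcdOn : ∀ {p} → 1 < p → ∀ {T i} → i ∈ elems T → ord p (gcdOn n T) ≡ minOn (λ j → ord p (n j)) T
  ord-gcdOn {p} 1<p {T} i∈ = ≤-antisym
    (≤minOn ordₚn T i∈ (All.tabulate (ord-gcdOn≤ 1<p)))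
    (^∣⇒≤ord 1<p (gcdOn>0 i∈)
      (Gcd.⋁-least n (_ ∣0) (All.tabulate λ j∈ → ≤ord⇒^∣ 1<p (minOn≤ ordₚn T j∈))))
    where
    ordₚn : Fin k → ℕ
    ordₚn j = ord p (n j)

lcmTuple : ∀ {k} → (Subset k → ℕ) → List (Subset k) → Vector ℕ k
lcmTuple f Qs i = Lcm.⋁ (λ T → if lookup T i then f T else 1) 1 Qs

module _ {k : ℕ} (f : Subset k → ℕ) where

  ∣lcmTuple : ∀ {Qs T i} → T ∈ Qs → lookup T i ≡ true → f T ∣ lcmTuple f Qs i
  ∣lcmTuple {Qs} {T} {i} T∈Qs T∋i =
    subst (_∣ lcmTuple f Qs i) (cong (λ b → if b then f T else 1) T∋i)
      (Lcm.∈⇒≼⋁ (λ T → if lookup T i then f T else 1) 1 T∈Qs)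

  lcmTuple>0 : ∀ {Qs} → All (λ T → 0 < f T) Qs → ∀ i → 0 < lcmTuple f Qs i
  lcmTuple>0 [] i = z<s
  lcmTuple>0 {T ∷ Qs} (fT>0 ∷ f>0) i with lookup T i
  ... | true  = lcm>0 fT>0 (lcmTuple>0 f>0 i)
  ... | false = lcm>0 z<s  (lcmTuple>0 f>0 i)

  ord-lcmTuple≤ : ∀ {p} → Prime p → ∀ {Qs} → All (λ T → 0 < f T) Qs → ∀ i →
    ord p (lcmTuple f Qs i) ≤ Max.⋁ (λ T → if lookup T i then ord p (f T) else 0) 0 Qs
  ord-lcmTuple≤ pr [] i = ≤-reflexive (ord[1]≡0 (prime⇒1< pr))
  ord-lcmTuple≤ {p} pr {T ∷ Qs} (fT>0 ∷ f>0) i with lookup T i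
  ... | true  = ≤-trans (ord-lcm≤ pr fT>0 (lcmTuple>0 f>0 i))
                        (⊔-monoʳ-≤ (ord p (f T)) (ord-lcmTuple≤ pr f>0 i))
  ... | false = ≤-trans (ord-lcm≤ pr z<s (lcmTuple>0 f>0 i))
                        (⊔-mono-≤ (≤-reflexive (ord[1]≡0 (prime⇒1< pr))) (ord-lcmTuple≤ pr f>0 i))

if-else-0≤ : ∀ b {x z} → (b ≡ true → x ≤ z) → (if b then x else 0) ≤ z
if-else-0≤ true  x≤z = x≤z refl
if-else-0≤ false _   = z≤n

ValuationCondition : ∀ {k} → GcdConditions k → Set
ValuationCondition C = (p : ℕ) → Prime p → All (λ T → g C p T ≡ minOn (v C p) T) (GcdConditions.Q C)

module _ {k : ℕ} (C : GcdConditions k) (wf : WellFormed C) where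
  open GcdConditions C

  ∃-∈-elems : ∀ {T} → T ∈ Q → ∃[ i ] i ∈ elems T
  ∃-∈-elems T∈Q = elems-nonempty (<⇒≤ (proj₁ (All.lookup wf T∈Q)))

  g≤v : ∀ p {T i} → T ∈ Q → lookup T i ≡ true → g C p T ≤ v C p i
  g≤v p {T} {i} T∈Q T∋i =
    subst (_≤ v C p i) (cong (λ b → if b then g C p T else 0) T∋i)
      (Max.∈⇒≼⋁ (λ T → if lookup T i then g C p T else 0) 0 T∈Q)

  v≤ord : ∀ {p n} → 1 < p → (∀ i → 0 < n i) → Satisfies C n → ∀ i → v C p i ≤ ord p (n i)
  v≤ord {p} {n} 1<p n>0 sat i = Max.⋁-least _ z≤n (All.tabulate λ {T} T∈Q →
    if-else-0≤ (lookup T i) λ T∋i → begin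
      g C p T             ≡⟨ cong (ord p) (All.lookup sat T∈Q) ⟩
      ord p (gcdOn n T)   ≤⟨ ord-gcdOn≤ n>0 1<p (∈-elems⁺ T∋i) ⟩
      ord p (n i)         ∎)
    where open ≤-Reasoning

  admissible⇒valuationCondition : Admissible C → ValuationCondition C
  admissible⇒valuationCondition (n , n>0 , sat) p pr = All.tabulate λ {T} T∈Q →
    let i , i∈T = ∃-∈-elems T∈Q in
    ≤-antisym
      (≤minOn (v C p) T i∈T (All.tabulate λ j∈T → g≤v p T∈Q (∈-elems⁻ j∈T)))
      (begin
        minOn (v C p) T                   ≤⟨ minOn-mono T i∈T (v≤ord 1<p n>0 sat) ⟩
        minOn (λ j → ord p (n j)) T       ≡⟨ ord-gcdOn n>0 1<p i∈T ⟨
        ord p (gcdOn n T)                 ≡⟨ cong (ord p) (All.lookup sat T∈Q) ⟨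
        g C p T                           ∎)
    where
    open ≤-Reasoning
    1<p = prime⇒1< pr

  valuationCondition⇒admissible : ValuationCondition C → Admissible C
  valuationCondition⇒admissible H = n , n>0 , All.tabulate f≡gcdOn
    where
    f>0 : All (λ T → 0 < f T) Q
    f>0 = All.map proj₂ wf
    n : Vector ℕ k
    n = lcmTuple f Q
    n>0 : ∀ i → 0 < n i
    n>0 = lcmTuple>0 f f>0
    f≡gcdOn : ∀ {T} → T ∈ Q → f T ≡ gcdOn n T
    f≡gcdOn {T} T∈Q = ∣⇒ord≤⇒≡
      (Gcd.⋁-least n (f T ∣0) (All.tabulate λ i∈T → ∣lcmTuple f T∈Q (∈-elems⁻ i∈T)))
      (gcdOn>0 n>0 i∈T)
      λ p pr → begin
        ord p (gcdOn n T)               ≡⟨ ord-gcdOn n>0 (prime⇒1< pr) i∈T ⟩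
        minOn (λ j → ord p (n j)) T     ≤⟨ minOn-mono T i∈T (ord-lcmTuple≤ f pr f>0) ⟩
        minOn (v C p) T                 ≡⟨ All.lookup (H p pr) T∈Q ⟨
        g C p T                         ∎
      where
      open ≤-Reasoning
      i∈T = proj₂ (∃-∈-elems T∈Q)

theorem1 : (k : ℕ) → 2 ≤ k → (C : GcdConditions k) →
    Unique (GcdConditions.Q C) → WellFormed C →
    Admissible C ⇔
      ((p : ℕ) → Prime p →
        All (λ T → g C p T ≡ minOn (v C p) T) (GcdConditions.Q C))
theorem1 k _ C _ wf = mk⇔ (admissible⇒valuationCondition C wf) (valuationCondition⇒admissible C wf)
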